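{- Let $A$ be a DLCMI and $f:A\to A$ a function. The following are equivalent: (1) $f$ is compatible; (2) there exists a function $g:A\times A\to A$ satisfying condition (M), compatible in the first variable, and such that for every $a\in A$ the set $\{b\in A: g(a,b)\le b\}$ has a minimum and $f(a)=\min\{b\in A: g(a,b)\le b\}$; (3) there exists a function $\hat g:A\times A\to A$ satisfying condition (M), compatible in the first variable, and such that for all $a,b\in A$: (i) $\hat g(a,f(a))\le f(a)$ and (ii) $f(a)\le \hat g(a,b)\vee b$. Moreover, a function $g:A\times A\to A$ satisfying (M) and compatible in the first variable witnesses (2) if and only if it witnesses (3).
   Context: A DLCMI is an algebra $(A,\wedge,\vee,\cdot,\to,1)$ of type $(2,2,2,2,0)$ such that for all $a,b,c\in A$: (1) $(A,\wedge,\vee)$ is a distributive lattice; (2) $1$ is the largest element; (3) $(A,\cdot,1)$ is a commutative monoid; (4) $(a\to b)\wedge(a\to c)=a\to(b\wedge c)$; (5) $(a\to c)\wedge(b\to c)=(a\vee b)\to c$; (6) $a\to a=1$; (7) $(a\vee b)\cdot c=(a\cdot c)\vee(b\cdot c)$; (8) $(a\to b)\cdot(b\to c)\le a\to c$; (9) $a\to b\le (a\cdot c)\to(b\cdot c)$. A function $h:A\to A$ is compatible if for every congruence $\theta$ of $A$ and all $a,b\in A$, $(a,b)\in\theta$ implies $(h(a),h(b))\in\theta$. A function $g:A\times A\to A$ satisfies condition (M) if for all $a,b,c\in A$, $c\ge b$ implies $g(a,c)\le g(a,b)$. $g$ is compatible in the first variable if for every $c\in A$ the unary function $x\mapsto g(x,c)$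 is compatible. -}

module Defs where

open import Level using (0ℓ)
open import Data.Product using (_×_; Σ)
open import Relation.Binary.Core using (Rel)
open import Relation.Binary.Structures using (IsEquivalence)
open import Relation.Binary.PropositionalEquality using (_≡_)
open import Algebra.Core using (Op₂)
open import Algebra.Structures using (IsCommutativeMonoid)
open import Algebra.Lattice.Structures using (IsDistributiveLattice)

record DLCMI : Set₁ where
  infixr 6 _∨_
  infixr 7 _∧_
  infixl 8 _·_
  infixr 5 _⇒_
  infix 4 _≤_
  field
    Carrier : Set
    _∧_ _∨_ _·_ _⇒_ : Op₂ Carrier
    𝟙 : Carrier

  _≤_ : Rel Carrier 0ℓ
  a ≤ b = a ∧ b ≡ a

  field
    isDistributiveLattice : IsDistributiveLattice _≡_ _∨_ _∧_
    𝟙-top       : ∀ a → a ≤ 𝟙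
    isCommutativeMonoid : IsCommutativeMonoid _≡_ _·_ 𝟙
    ax4 : ∀ a b c → ((a ⇒ b) ∧ (a ⇒ c)) ≡ (a ⇒ (b ∧ c))
    ax5 : ∀ a b c → ((a ⇒ c) ∧ (b ⇒ c)) ≡ ((a ∨ b) ⇒ c)
    ax6 : ∀ a → (a ⇒ a) ≡ 𝟙
    ax7 : ∀ a b c → ((a ∨ b) · c) ≡ ((a · c) ∨ (b · c))
    ax8 : ∀ a b c → ((a ⇒ b) · (b ⇒ c)) ≤ (a ⇒ c)
    ax9 : ∀ a b c → (a ⇒ b) ≤ ((a · c) ⇒ (b · c))

module _ (A : DLCMI) where
  open DLCMI A

  record IsCongruence (θ : Rel Carrier 0ℓ) : Set where
    field
      isEquivalence : IsEquivalence θ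
      ∧-cong : ∀ {a b c d} → θ a b → θ c d → θ (a ∧ c) (b ∧ d)
      ∨-cong : ∀ {a b c d} → θ a b → θ c d → θ (a ∨ c) (b ∨ d)
      ·-cong : ∀ {a b c d} → θ a b → θ c d → θ (a · c) (b · d)
      ⇒-cong : ∀ {a b c d} → θ a b → θ c d → θ (a ⇒ c) (b ⇒ d)

  Compatible : (Carrier → Carrier) → Set₁
  Compatible h = ∀ (θ : Rel Carrier 0ℓ) → IsCongruence θ →
                 ∀ a b → θ a b → θ (h a) (h b)

  ConditionM : (Carrier → Carrier → Carrier) → Set
  ConditionM g = ∀ a b c → b ≤ c → g a c ≤ g a b

  CompatibleFirst : (Carrier → Carrier → Carrier) → Set₁
  CompatibleFirst g = ∀ c → Compatible (λ x → g x c)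

  IsMinimum : (Carrier → Set) → Carrier → Set
  IsMinimum P m = P m × (∀ c → P c → m ≤ c)

  Witness2 : (Carrier → Carrier) → (Carrier → Carrier → Carrier) → Set
  Witness2 f g = ∀ a → IsMinimum (λ b → g a b ≤ b) (f a)

  Witness3 : (Carrier → Carrier) → (Carrier → Carrier → Carrier) → Set
  Witness3 f g = (∀ a → g a (f a) ≤ f a) × (∀ a b → f a ≤ (g a b ∨ b))

module Submission where

-- (1) ⇒ (2) is witnessed by g(a, b) = f(a). For (3) ⇒ (1), let θ a b: then g a (f b) θ g b (f b) ≤ f b,
-- and f a ≤ g a (f b) ∨ f b, so f a ∨ f b θ f b; by symmetry f a ∨ f b θ f a as well.

open import Defs
open import Data.Product using (_×_; Σ; _,_; proj₁; proj₂)
open import Function.Bundles using (_⇔_; mk⇔)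
open import Relation.Binary.Core using (Rel)
open import Relation.Binary.Bundles using (Setoid)
open import Relation.Binary.PropositionalEquality using (_≡_; sym; trans; cong; subst)
open import Algebra.Core using (Op₂)
open import Algebra.Lattice.Structures using (IsLattice; IsDistributiveLattice)
import Relation.Binary.Reasoning.Setoid as SetoidReasoning

module LatticeOrder {C : Set} {_∨_ _∧_ : Op₂ C} (isLattice : IsLattice _≡_ _∨_ _∧_) where
  open IsLattice isLattice using (∨-comm; ∧-comm; ∧-assoc; absorptive)

  infix 4 _≤_
  _≤_ : Rel C _
  a ≤ b = a ∧ b ≡ a

  ∨-absorbs-∧ : ∀ x y → x ∨ (x ∧ y) ≡ x
  ∨-absorbs-∧ = proj₁ absorptive

  ∧-absorbs-∨ : ∀ x y → x ∧ (x ∨ y) ≡ x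
  ∧-absorbs-∨ = proj₂ absorptive

  ≤-refl : ∀ x → x ≤ x
  ≤-refl x = trans (cong (x ∧_) (sym (∨-absorbs-∧ x x))) (∧-absorbs-∨ x (x ∧ x))

  ≤-trans : ∀ {x y z} → x ≤ y → y ≤ z → x ≤ z
  ≤-trans {x} {y} {z} x≤y y≤z =
    trans (cong (_∧ z) (sym x≤y)) (trans (∧-assoc x y z) (trans (cong (x ∧_) y≤z) x≤y))

  x≤x∨y : ∀ x y → x ≤ x ∨ y
  x≤x∨y = ∧-absorbs-∨

  y≤x∨y : ∀ x y → y ≤ x ∨ y
  y≤x∨y x y = trans (cong (y ∧_) (∨-comm x y)) (∧-absorbs-∨ y x)

  ≤⇒∨≡ : ∀ {x y} → x ≤ y → x ∨ y ≡ y
  ≤⇒∨≡ {x} {y} x≤y = begin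
    x ∨ y        ≡⟨ cong (_∨ y) (sym x≤y) ⟩
    (x ∧ y) ∨ y  ≡⟨ ∨-comm (x ∧ y) y ⟩
    y ∨ (x ∧ y)  ≡⟨ cong (y ∨_) (∧-comm x y) ⟩
    y ∨ (y ∧ x)  ≡⟨ ∨-absorbs-∧ y x ⟩
    y            ∎
    where open Relation.Binary.PropositionalEquality.≡-Reasoning

module _ (A : DLCMI) where
  open DLCMI A hiding (_≤_)
  open IsDistributiveLattice isDistributiveLattice using (isLattice; ∨-comm)
  open LatticeOrder isLattice

  witness2⇒witness3 : ∀ {f g} → ConditionM A g → Witness2 A f g → Witness3 A f g
  witness2⇒witness3 {f} {g} M w2 = (λ a → proj₁ (w2 a)) , below-join
    where
    -- g a b ∨ b is a prefixed point of g a: by (M), g a (g a b ∨ b) ≤ g a b ≤ g a b ∨ b.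
    below-join : ∀ a b → f a ≤ g a b ∨ b
    below-join a b = proj₂ (w2 a) (g a b ∨ b)
      (≤-trans (M a b (g a b ∨ b) (y≤x∨y (g a b) b)) (x≤x∨y (g a b) b))

  witness3⇒witness2 : ∀ {f g} → Witness3 A f g → Witness2 A f g
  witness3⇒witness2 {f} {g} (prefixed , below-join) a =
    prefixed a , λ c gac≤c → subst (f a ≤_) (≤⇒∨≡ gac≤c) (below-join a c)

  witness3⇒compatible : ∀ {f g} → CompatibleFirst A g → Witness3 A f g → Compatible A f
  witness3⇒compatible {f} {g} compat (prefixed , below-join) θ isCongruence a b θab = begin
    f a        ≈⟨ θ-sym (join-related (θ-sym θab)) ⟩
    f b ∨ f a  ≡⟨ ∨-comm (f b) (f a) ⟩
    f a ∨ f b  ≈⟨ join-related θab ⟩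
    f b        ∎
    where
    open IsCongruence isCongruence using (isEquivalence; ∨-cong)
    θ-setoid : Setoid _ _
    θ-setoid = record { Carrier = Carrier ; _≈_ = θ ; isEquivalence = isEquivalence }
    open Setoid θ-setoid using () renaming (refl to θ-refl; sym to θ-sym)
    open SetoidReasoning θ-setoid

    join-related : ∀ {x y} → θ x y → θ (f x ∨ f y) (f y)
    join-related {x} {y} θxy = begin
      f x ∨ f y                ≡⟨ cong (f x ∨_) (sym (≤⇒∨≡ (prefixed y))) ⟩
      f x ∨ (g y (f y) ∨ f y)  ≈⟨ ∨-cong θ-refl (∨-cong (θ-sym g-related) θ-refl) ⟩
      f x ∨ (g x (f y) ∨ f y)  ≡⟨ ≤⇒∨≡ (below-join x (f y)) ⟩
      g x (f y) ∨ f y          ≈⟨ ∨-cong g-related θ-refl ⟩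
      g y (f y) ∨ f y          ≡⟨ ≤⇒∨≡ (prefixed y) ⟩
      f y                      ∎
      where
      g-related : θ (g x (f y)) (g y (f y))
      g-related = compat (f y) θ isCongruence x y θxy

  compatible⇒witness2 : ∀ {f} → Compatible A f →
    Σ (Carrier → Carrier → Carrier) (λ g → ConditionM A g × CompatibleFirst A g × Witness2 A f g)
  compatible⇒witness2 {f} compat =
    (λ a _ → f a) , (λ a _ _ _ → ≤-refl (f a)) , (λ _ → compat) , λ a → ≤-refl (f a) , λ _ fa≤c → fa≤c

  compatible⇒witness3 : ∀ {f} → Compatible A f →
    Σ (Carrier → Carrier → Carrier) (λ g → ConditionM A g × CompatibleFirst A g × Witness3 A f g)
  compatible⇒witness3 compat with compatible⇒witness2 compat
  ... | g , M , compatFirst , w2 = g , M , compatFirst , witness2⇒witness3 M w2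

  witness2⇒compatible : ∀ {f g} → ConditionM A g → CompatibleFirst A g → Witness2 A f g → Compatible A f
  witness2⇒compatible M compat w2 = witness3⇒compatible compat (witness2⇒witness3 M w2)

proposition4p8 : (A : DLCMI) → (f : DLCMI.Carrier A → DLCMI.Carrier A) →
    ((Compatible A f ⇔ Σ (DLCMI.Carrier A → DLCMI.Carrier A → DLCMI.Carrier A)
        (λ g → ConditionM A g × CompatibleFirst A g × Witness2 A f g))
    × (Compatible A f ⇔ Σ (DLCMI.Carrier A → DLCMI.Carrier A → DLCMI.Carrier A)
        (λ g → ConditionM A g × CompatibleFirst A g × Witness3 A f g)))
    × (∀ (g : DLCMI.Carrier A → DLCMI.Carrier A → DLCMI.Carrier A) →
        ConditionM A g → CompatibleFirst A g → (Witness2 A f g ⇔ Witness3 A f g))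
proposition4p8 A f =
  ( mk⇔ (compatible⇒witness2 A) (λ (_ , M , compat , w2) → witness2⇒compatible A M compat w2)
  , mk⇔ (compatible⇒witness3 A) (λ (_ , _ , compat , w3) → witness3⇒compatible A compat w3) )
  , λ _ M _ → mk⇔ (witness2⇒witness3 A M) (witness3⇒witness2 A)
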